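{- Let $w\in\mathfrak{S}_n$ be Bruhat irreducible and almost reducible at $(J,i)$. Then $s_i$ commutes with every element of $D_L(w)\cap D_R(w)$.
   Context: $\mathfrak{S}_n$ is the Coxeter group with simple generators $S=\{s_1,\dots,s_{n-1}\}$, $s_i=(i\ i+1)$, length $\ell$. $\supp(x)$ is the set of simple generators in any reduced word of $x$; $D_L(x)=\{s\in S:\ell(sx)<\ell(x)\}$, $D_R(x)=\{s\in S:\ell(xs)<\ell(x)\}$. For $J\subseteq S$, $W_J=\langle J\rangle$ and each $x$ factors uniquely as $x=x^Jx_J$, $x_J\in W_J$, $x^J$ the minimal-length element of $xW_J$. $w=w^Jw_J$ is a Billey–Postnikov decomposition if $\supp(w^J)\cap J\subseteq D_L(w_J)$. $w$ is Bruhat irreducible if $\supp(w)=S$ and there is no factorization $w=w'w''$ with $w',w''\neq e$ and $\supp(w')\cap\supp(w'')=\emptyset$. A Bruhat irreducible $w$ is almost reducible at $(J,i)$ if $w=w^Jw_J$ is a BP decomposition with $\supp(w^J)\cap J=\{s_i\}$ and $s_i\notin D_L(w)\cup D_R(w)$. -}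

module Defs where

open import Data.Nat using (ℕ; suc; _≤_; _<_)
open import Data.Fin using (Fin; inject₁) renaming (suc to fsuc)
open import Data.Fin.Properties using () renaming (_≟_ to _≟ᶠ_)
open import Data.Fin.Subset using (Subset) renaming (_∈_ to _∈ˢ_)
open import Data.List using (List; []; _∷_; _++_; length)
open import Data.List.Membership.Propositional using () renaming (_∈_ to _∈ˡ_)
open import Data.List.Relation.Unary.All using (All)
open import Data.Product using (Σ; ∃; _×_; _,_)
open import Data.Empty using (⊥)
open import Relation.Nullary using (¬_; yes; no)
open import Relation.Binary.PropositionalEquality using (_≡_)
open import Function using (_∘_; id)

-- We work in 𝔖_{m+1}, acting on Fin (suc m).  The simple generators are
-- s_i for i : Fin m, where s_i swaps the points i and i+1.
-- Elements are represented by words in the generators (every permutation is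
-- such a product); two words represent the same element iff they act equally.

swapAt : ∀ {m} → Fin m → Fin (suc m) → Fin (suc m)
swapAt i k with k ≟ᶠ inject₁ i
... | yes _ = fsuc i
... | no _ with k ≟ᶠ fsuc i
...   | yes _ = inject₁ i
...   | no _ = k

Word : ℕ → Set
Word m = List (Fin m)

-- product convention: the word s_{i1} ⋯ s_{ik} is the map s_{i1} ∘ ⋯ ∘ s_{ik};
-- the product x y of group elements is concatenation x ++ y.
eval : ∀ {m} → Word m → Fin (suc m) → Fin (suc m)
eval [] = id
eval (i ∷ w) = swapAt i ∘ eval w

_≈_ : ∀ {m} → Word m → Word m → Set
x ≈ y = ∀ k → eval x k ≡ eval y k

Reduced : ∀ {m} → Word m → Word m → Set
Reduced u x = u ≈ x × (∀ v → v ≈ x → length u ≤ length v)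

Len : ∀ {m} → Word m → ℕ → Set
Len x k = Σ _ λ u → Reduced u x × length u ≡ k

_∈supp_ : ∀ {m} → Fin m → Word m → Set
s ∈supp x = Σ _ λ u → Reduced u x × s ∈ˡ u

DL : ∀ {m} → Word m → Fin m → Set
DL x s = Σ ℕ λ k → Σ ℕ λ k' → Len (s ∷ x) k × Len x k' × k < k'

DR : ∀ {m} → Word m → Fin m → Set
DR x s = Σ ℕ λ k → Σ ℕ λ k' → Len (x ++ (s ∷ [])) k × Len x k' × k < k'

InParabolic : ∀ {m} → Subset m → Word m → Set
InParabolic J x = Σ _ λ u → u ≈ x × All (_∈ˢ J) u

MinInCoset : ∀ {m} → Subset m → Word m → Word m → Set
MinInCoset J x u =
  (Σ _ λ y → InParabolic J y × u ≈ (x ++ y)) ×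
  (∀ y → InParabolic J y → ∀ k k' → Len u k → Len (x ++ y) k' → k ≤ k')

ParabolicDecomp : ∀ {m} → Subset m → Word m → Word m → Word m → Set
ParabolicDecomp J x u v = MinInCoset J x u × InParabolic J v × x ≈ (u ++ v)

BPDecomp : ∀ {m} → Subset m → Word m → Word m → Word m → Set
BPDecomp J x u v =
  ParabolicDecomp J x u v × (∀ s → s ∈supp u → s ∈ˢ J → DL v s)

IsId : ∀ {m} → Word m → Set
IsId x = x ≈ []

BruhatIrreducible : ∀ {m} → Word m → Set
BruhatIrreducible w =
  (∀ s → s ∈supp w) ×
  ¬ (Σ _ λ w' → Σ _ λ w'' → w ≈ (w' ++ w'') × ¬ IsId w' × ¬ IsId w'' ×
       (∀ s → s ∈supp w' → s ∈supp w'' → ⊥))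

AlmostReducible : ∀ {m} → Word m → Subset m → Fin m → Set
AlmostReducible w J i =
  BruhatIrreducible w ×
  (Σ _ λ u → Σ _ λ v → BPDecomp J w u v ×
     (∀ s → (s ∈supp u × s ∈ˢ J → s ≡ i) × (s ≡ i → s ∈supp u × s ∈ˢ J))) ×
  ¬ DL w i × ¬ DR w i

-- Model 𝔖_{m+1} by bijections of ℕ fixing every point > m, the generator s_c acting as the
-- transposition τ c of c and c+1. Lengths are then inversion numbers, s_j ∈ supp(x) iff x sends some
-- point ≤ j above j, and s_c is a left (right) descent of x iff x⁻¹ (x) decreases from c to c+1.
-- Write w = uv with u = w^J, v = w_J, and let s_t ∈ D_L(w) ∩ D_R(w) with t = i ± 1. Each neighbour
-- s_{i±1} of s_i lies outside supp(u) or outside J, so u or v preserves the corresponding initial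
-- segment of points. Comparing the values of w and w⁻¹ around i, every combination either contradicts
-- one of s_i ∉ D_R(u), s_i ∈ supp(u), s_i ∈ D_L(v), s_i ∉ D_R(w), or shows that w or w⁻¹ maps
-- {0,…,k} into {0,…,k+1} for some k with s_{k+1} ∈ S. Then w is the product, in some order, of a
-- nontrivial element of ⟨s₀,…,s_k⟩ and one of ⟨s_{k+1},…⟩, contradicting Bruhat irreducibility.
-- Hence |t − i| ≠ 1, so s_t commutes with s_i.

module Submission where

open import Data.Empty using (⊥; ⊥-elim)
open import Data.Fin using (Fin; toℕ; fromℕ<; inject₁) renaming (suc to fsuc)
open import Data.Fin.Properties using (toℕ<n; toℕ-fromℕ<; toℕ-injective; toℕ-inject₁; any?; injective⇒≤)
  renaming (_≟_ to _≟ᶠ_)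
open import Data.Fin.Subset using (Subset) renaming (_∈_ to _∈ˢ_)
open import Data.Fin.Subset.Properties using () renaming (_∈?_ to _∈ˢ?_)
open import Data.List using ([]; _∷_; _++_; length; reverse)
open import Data.List.Membership.Propositional using (_∈_)
open import Data.List.Properties using (unfold-reverse; reverse-involutive)
open import Data.List.Relation.Unary.All as All using (All; []; _∷_)
open import Data.List.Relation.Unary.All.Properties using (¬Any⇒All¬; ++⁺)
open import Data.List.Relation.Unary.Any using (here; there)
open import Data.Nat
open import Data.Nat.Induction using (<-rec)
open import Data.Nat.Properties
open import Data.Nat.Tactic.RingSolver using (solve-∀)
open import Algebra.Properties.CommutativeSemigroup +-commutativeSemigroup using (xy∙z≈xz∙y)
open import Data.Product using (Σ; ∃; _×_; _,_; proj₁; proj₂)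
open import Data.Sum as Sum using (_⊎_; inj₁; inj₂)
open import Function using (_∘_; id)
open import Relation.Binary.Definitions using (tri<; tri≈; tri>)
open import Relation.Binary.PropositionalEquality hiding ([_])
open import Relation.Nullary using (¬_; Dec; yes; no)
open import Relation.Nullary.Decidable using (map′)

open import Defs

open ≡-Reasoning

-- Adjacent transpositions of ℕ

τ : ℕ → ℕ → ℕ
τ zero    zero          = 1
τ zero    (suc zero)    = 0
τ zero    (suc (suc a)) = suc (suc a)
τ (suc c) zero          = zero
τ (suc c) (suc a)       = suc (τ c a)

τ-at : ∀ c → τ c c ≡ suc c
τ-at zero    = refl
τ-at (suc c) = cong suc (τ-at c)

τ-at-suc : ∀ c → τ c (suc c) ≡ c
τ-at-suc zero    = refl
τ-at-suc (suc c) = cong suc (τ-at-suc c)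

τ-fix : ∀ {c a} → a ≢ c → a ≢ suc c → τ c a ≡ a
τ-fix {zero}  {zero}          a≢c _ = ⊥-elim (a≢c refl)
τ-fix {zero}  {suc zero}      _ a≢1+c = ⊥-elim (a≢1+c refl)
τ-fix {zero}  {suc (suc a)}   _ _ = refl
τ-fix {suc c} {zero}          _ _ = refl
τ-fix {suc c} {suc a} a≢c a≢1+c = cong suc (τ-fix (a≢c ∘ cong suc) (a≢1+c ∘ cong suc))

τ-fix-below : ∀ {c a} → a < c → τ c a ≡ a
τ-fix-below a<c = τ-fix (<⇒≢ a<c) (<⇒≢ (m<n⇒m<1+n a<c))

τ-fix-above : ∀ {c a} → suc c < a → τ c a ≡ a
τ-fix-above {c} 1+c<a = τ-fix (>⇒≢ (<-trans (n<1+n c) 1+c<a)) (>⇒≢ 1+c<a)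

τ-involutive : ∀ c a → τ c (τ c a) ≡ a
τ-involutive zero    zero          = refl
τ-involutive zero    (suc zero)    = refl
τ-involutive zero    (suc (suc a)) = refl
τ-involutive (suc c) zero          = refl
τ-involutive (suc c) (suc a)       = cong suc (τ-involutive c a)

τ-comm : ∀ {c d} → c ≢ suc d → d ≢ suc c → ∀ a → τ c (τ d a) ≡ τ d (τ c a)
τ-comm {zero}        {zero}        _ _ a = refl
τ-comm {zero}        {suc zero}    _ d≢1+c _ = ⊥-elim (d≢1+c refl)
τ-comm {zero}        {suc (suc d)} _ _ zero = refl
τ-comm {zero}        {suc (suc d)} _ _ (suc zero) = refl
τ-comm {zero}        {suc (suc d)} _ _ (suc (suc a)) = refl
τ-comm {suc zero}    {zero}        c≢1+d _ _ = ⊥-elim (c≢1+d refl)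
τ-comm {suc (suc c)} {zero}        _ _ zero = refl
τ-comm {suc (suc c)} {zero}        _ _ (suc zero) = refl
τ-comm {suc (suc c)} {zero}        _ _ (suc (suc a)) = refl
τ-comm {suc c}       {suc d}       _ _ zero = refl
τ-comm {suc c}       {suc d} c≢1+d d≢1+c (suc a) =
  cong suc (τ-comm (c≢1+d ∘ cong suc) (d≢1+c ∘ cong suc) a)

data TauView (c a : ℕ) : Set where
  at-c     : a ≡ c → τ c a ≡ suc c → TauView c a
  at-suc-c : a ≡ suc c → τ c a ≡ c → TauView c a
  fixed    : a ≢ c → a ≢ suc c → τ c a ≡ a → TauView c a

τ-view : ∀ c a → TauView c a
τ-view c a with a ≟ c | a ≟ suc c
... | yes refl | _        = at-c refl (τ-at c)
... | no _     | yes refl = at-suc-c refl (τ-at-suc c)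
... | no a≢c   | no a≢1+c = fixed a≢c a≢1+c (τ-fix a≢c a≢1+c)

-- Iverson brackets and finite sums

[_<_] : ℕ → ℕ → ℕ
[ _     < zero  ] = 0
[ zero  < suc _ ] = 1
[ suc a < suc b ] = [ a < b ]

[<]-yes : ∀ {a b} → a < b → [ a < b ] ≡ 1
[<]-yes {zero}  {suc b} _         = refl
[<]-yes {suc a} {suc b} (s<s a<b) = [<]-yes a<b

[<]-no : ∀ {a b} → b ≤ a → [ a < b ] ≡ 0
[<]-no {a}     {zero}  _         = refl
[<]-no {suc a} {suc b} (s≤s b≤a) = [<]-no b≤a

[<]*-yes : ∀ {x y} n → x < y → [ x < y ] * n ≡ n
[<]*-yes n x<y = trans (cong (_* n) ([<]-yes x<y)) (*-identityˡ n)

[<]*-no : ∀ {x y} n → y ≤ x → [ x < y ] * n ≡ 0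
[<]*-no n y≤x = cong (_* n) ([<]-no y≤x)

*[<]-yes : ∀ {x y} n → x < y → n * [ x < y ] ≡ n
*[<]-yes n x<y = trans (*-comm n _) ([<]*-yes n x<y)

*[<]-no : ∀ {x y} n → y ≤ x → n * [ x < y ] ≡ 0
*[<]-no n y≤x = trans (*-comm n _) ([<]*-no n y≤x)

[<]-asym : ∀ a b → [ a < b ] * [ b < a ] ≡ 0
[<]-asym zero    zero    = refl
[<]-asym zero    (suc b) = refl
[<]-asym (suc a) zero    = refl
[<]-asym (suc a) (suc b) = [<]-asym a b

[<]-τ : ∀ c x y → ¬ (x ≡ c × y ≡ suc c) → ¬ (x ≡ suc c × y ≡ c) →
        [ τ c x < τ c y ] ≡ [ x < y ]
[<]-τ zero    zero          zero          _ _ = refl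
[<]-τ zero    zero          (suc zero)    h _ = ⊥-elim (h (refl , refl))
[<]-τ zero    zero          (suc (suc y)) _ _ = refl
[<]-τ zero    (suc zero)    zero          _ h = ⊥-elim (h (refl , refl))
[<]-τ zero    (suc zero)    (suc zero)    _ _ = refl
[<]-τ zero    (suc zero)    (suc (suc y)) _ _ = refl
[<]-τ zero    (suc (suc x)) zero          _ _ = refl
[<]-τ zero    (suc (suc x)) (suc zero)    _ _ = refl
[<]-τ zero    (suc (suc x)) (suc (suc y)) _ _ = refl
[<]-τ (suc c) zero          zero          _ _ = refl
[<]-τ (suc c) zero          (suc y)       _ _ = refl
[<]-τ (suc c) (suc x)       zero          _ _ = refl
[<]-τ (suc c) (suc x)       (suc y)       h₁ h₂ =
  [<]-τ c x y (λ (e₁ , e₂) → h₁ (cong suc e₁ , cong suc e₂)) (λ (e₁ , e₂) → h₂ (cong suc e₁ , cong suc e₂))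

[<]-step-up : ∀ {X Y P Q} → X + [ Q < P ] ≡ Y + [ P < Q ] → P < Q → X ≡ suc Y
[<]-step-up {X} {Y} {P} {Q} eq P<Q = begin
  X             ≡⟨ +-identityʳ X ⟨
  X + 0         ≡⟨ cong (X +_) ([<]-no (<⇒≤ P<Q)) ⟨
  X + [ Q < P ] ≡⟨ eq ⟩
  Y + [ P < Q ] ≡⟨ cong (Y +_) ([<]-yes P<Q) ⟩
  Y + 1         ≡⟨ +-comm Y 1 ⟩
  suc Y         ∎

[<]-step-down : ∀ {X Y P Q} → X + [ Q < P ] ≡ Y + [ P < Q ] → Q < P → suc X ≡ Y
[<]-step-down {X} {Y} eq Q<P = sym ([<]-step-up (sym eq) Q<P)

∑ : ℕ → (ℕ → ℕ) → ℕ
∑ zero    f = 0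
∑ (suc n) f = ∑ n f + f n

∑∑ : ℕ → (ℕ → ℕ → ℕ) → ℕ
∑∑ n H = ∑ n (λ a → ∑ n (H a))

∑-cong : ∀ n {f g : ℕ → ℕ} → (∀ {a} → a < n → f a ≡ g a) → ∑ n f ≡ ∑ n g
∑-cong zero    _   = refl
∑-cong (suc n) f≗g = cong₂ _+_ (∑-cong n (f≗g ∘ m<n⇒m<1+n)) (f≗g (n<1+n n))

∑-zero : ∀ n {f : ℕ → ℕ} → (∀ {a} → a < n → f a ≡ 0) → ∑ n f ≡ 0
∑-zero zero    _   = refl
∑-zero (suc n) f≗0 = cong₂ _+_ (∑-zero n (f≗0 ∘ m<n⇒m<1+n)) (f≗0 (n<1+n n))

∑-τ : ∀ n {j} → suc j < n → (f : ℕ → ℕ) → ∑ n (f ∘ τ j) ≡ ∑ n f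
∑-τ (suc n) {j} 1+j<1+n f with m<1+n⇒m<n∨m≡n 1+j<1+n
... | inj₁ 1+j<n =
  cong₂ _+_ (∑-τ n 1+j<n f) (cong f (τ-fix-above 1+j<n))
... | inj₂ refl = begin
  ∑ j (f ∘ τ j) + f (τ j j) + f (τ j (suc j)) ≡⟨ cong₂ (λ s x → s + x + f (τ j (suc j))) ∑-below (cong f (τ-at j)) ⟩
  ∑ j f + f (suc j) + f (τ j (suc j))         ≡⟨ cong (λ x → ∑ j f + f (suc j) + f x) (τ-at-suc j) ⟩
  ∑ j f + f (suc j) + f j                     ≡⟨ xy∙z≈xz∙y (∑ j f) _ _ ⟩
  ∑ j f + f j + f (suc j)                     ∎
  where
  ∑-below : ∑ j (f ∘ τ j) ≡ ∑ j f
  ∑-below = ∑-cong j (λ a<j → cong f (τ-fix-below a<j))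

∑∑-τ : ∀ n {c} → suc c < n → (G : ℕ → ℕ → ℕ) → ∑∑ n (λ a b → G (τ c a) (τ c b)) ≡ ∑∑ n G
∑∑-τ n {c} 1+c<n G =
  trans (∑-cong n (λ {a} _ → ∑-τ n 1+c<n (G (τ c a)))) (∑-τ n 1+c<n (λ a → ∑ n (G a)))

∑-update : ∀ n {f f′ : ℕ → ℕ} {P} → P < n → (∀ {a} → a < n → a ≢ P → f′ a ≡ f a) →
           ∑ n f′ + f P ≡ ∑ n f + f′ P
∑-update (suc n) {f} {f′} {P} P<1+n agree with m<1+n⇒m<n∨m≡n P<1+n
... | inj₂ refl = begin
  ∑ n f′ + f′ n + f n ≡⟨ xy∙z≈xz∙y (∑ n f′) _ _ ⟩
  ∑ n f′ + f n + f′ n ≡⟨ cong (λ s → s + f n + f′ n) (∑-cong n (λ a<n → agree (m<n⇒m<1+n a<n) (<⇒≢ a<n))) ⟩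
  ∑ n f + f n + f′ n  ∎
... | inj₁ P<n = begin
  ∑ n f′ + f′ n + f P ≡⟨ xy∙z≈xz∙y (∑ n f′) _ _ ⟩
  ∑ n f′ + f P + f′ n ≡⟨ cong₂ _+_ (∑-update n P<n (agree ∘ m<n⇒m<1+n)) (agree (n<1+n n) (>⇒≢ P<n)) ⟩
  ∑ n f + f′ P + f n  ≡⟨ xy∙z≈xz∙y (∑ n f) _ _ ⟩
  ∑ n f + f n + f′ P  ∎

∑-update₂ : ∀ n {f f′ : ℕ → ℕ} {P Q} → P < n → Q < n → P ≢ Q →
            (∀ {a} → a < n → a ≢ P → a ≢ Q → f′ a ≡ f a) →
            ∑ n f′ + f P + f Q ≡ ∑ n f + f′ P + f′ Q
∑-update₂ n {f} {f′} {P} {Q} P<n Q<n P≢Q agree = begin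
  ∑ n f′ + f P + f Q  ≡⟨ xy∙z≈xz∙y (∑ n f′) _ _ ⟩
  ∑ n f′ + f Q + f P  ≡⟨ cong (λ x → ∑ n f′ + x + f P) (sym g-at-Q) ⟩
  ∑ n f′ + g Q + f P  ≡⟨ cong (_+ f P) (∑-update n Q<n (λ _ a≢Q → sym (g-off a≢Q))) ⟩
  ∑ n g + f′ Q + f P  ≡⟨ xy∙z≈xz∙y (∑ n g) _ _ ⟩
  ∑ n g + f P + f′ Q  ≡⟨ cong (_+ f′ Q) (∑-update n P<n g≗f-off-P) ⟩
  ∑ n f + g P + f′ Q  ≡⟨ cong (λ x → ∑ n f + x + f′ Q) (g-off P≢Q) ⟩
  ∑ n f + f′ P + f′ Q ∎
  where
  g : ℕ → ℕ
  g a with a ≟ Q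
  ... | yes _ = f Q
  ... | no _  = f′ a
  g-at-Q : g Q ≡ f Q
  g-at-Q with Q ≟ Q
  ... | yes _   = refl
  ... | no Q≢Q = ⊥-elim (Q≢Q refl)
  g-off : ∀ {a} → a ≢ Q → g a ≡ f′ a
  g-off {a} a≢Q with a ≟ Q
  ... | yes a≡Q = ⊥-elim (a≢Q a≡Q)
  ... | no _    = refl
  g≗f-off-P : ∀ {a} → a < n → a ≢ P → g a ≡ f a
  g≗f-off-P {a} a<n a≢P with a ≟ Q
  ... | yes refl = refl
  ... | no a≢Q   = agree a<n a≢P a≢Q

∑∑-update₂ : ∀ n (H H′ : ℕ → ℕ → ℕ) {P Q} → P < n → Q < n → P ≢ Q →
  (∀ {a b} → a < n → b < n → ¬ (a ≡ P × b ≡ Q) → ¬ (a ≡ Q × b ≡ P) → H′ a b ≡ H a b) →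
  ∑∑ n H′ + H P Q + H Q P ≡ ∑∑ n H + H′ P Q + H′ Q P
∑∑-update₂ n H H′ {P} {Q} P<n Q<n P≢Q agree = +-cancelʳ-≡ (R P + R Q) _ _ (begin
  ∑∑ n H′ + H P Q + H Q P + (R P + R Q)    ≡⟨ shuffle (∑∑ n H′) _ _ _ _ ⟩
  ∑∑ n H′ + R P + R Q + H P Q + H Q P      ≡⟨ cong (λ s → s + H P Q + H Q P) rows ⟩
  ∑∑ n H + R′ P + R′ Q + H P Q + H Q P     ≡⟨ regroup (∑∑ n H) _ _ _ _ ⟩
  ∑∑ n H + (R′ P + H P Q) + (R′ Q + H Q P) ≡⟨ cong₂ (λ x y → ∑∑ n H + x + y) row-P row-Q ⟩
  ∑∑ n H + (R P + H′ P Q) + (R Q + H′ Q P) ≡⟨ regroup′ (∑∑ n H) _ _ _ _ ⟩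
  ∑∑ n H + H′ P Q + H′ Q P + (R P + R Q)      ∎)
  where
  R R′ : ℕ → ℕ
  R  a = ∑ n (H a)
  R′ a = ∑ n (H′ a)
  rows : ∑∑ n H′ + R P + R Q ≡ ∑∑ n H + R′ P + R′ Q
  rows = ∑-update₂ n P<n Q<n P≢Q (λ a<n a≢P a≢Q →
           ∑-cong n (λ b<n → agree a<n b<n (a≢P ∘ proj₁) (a≢Q ∘ proj₁)))
  row-P : R′ P + H P Q ≡ R P + H′ P Q
  row-P = ∑-update n Q<n (λ b<n b≢Q → agree P<n b<n (b≢Q ∘ proj₂) (P≢Q ∘ proj₁))
  row-Q : R′ Q + H Q P ≡ R Q + H′ Q P
  row-Q = ∑-update n P<n (λ b<n b≢P → agree Q<n b<n (P≢Q ∘ sym ∘ proj₁) (b≢P ∘ proj₂))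
  shuffle : ∀ s a b c d → s + a + b + (c + d) ≡ s + c + d + a + b
  shuffle = solve-∀
  regroup : ∀ s a b c d → s + a + b + c + d ≡ s + (a + c) + (b + d)
  regroup = solve-∀
  regroup′ : ∀ s a b c d → s + (a + c) + (b + d) ≡ s + c + d + (a + b)
  regroup′ = solve-∀

-- Injective maps of ℕ and initial segments

Cross : ℕ → (ℕ → ℕ) → Set
Cross j f = ∃ λ a → a ≤ j × j < f a

Preserves : (ℕ → ℕ) → ℕ → Set
Preserves f j = ∀ {a} → a ≤ j → f a ≤ j

PreservesBelow : (ℕ → ℕ) → ℕ → Set
PreservesBelow f i = ∀ {a} → a < i → f a < i

AlmostPreserves : (ℕ → ℕ) → ℕ → Set
AlmostPreserves f k = ∀ {a} → a ≤ k → f a ≤ suc k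

select : ℕ → (ℕ → ℕ) → (ℕ → ℕ) → ℕ → ℕ
select k f g a with a ≤? k
... | yes _ = f a
... | no  _ = g a

select-≤ : ∀ {k f g a} → a ≤ k → select k f g a ≡ f a
select-≤ {k} {a = a} a≤k with a ≤? k
... | yes _   = refl
... | no  a≰k = ⊥-elim (a≰k a≤k)

select-> : ∀ {k f g a} → k < a → select k f g a ≡ g a
select-> {k} {a = a} k<a with a ≤? k
... | yes a≤k = ⊥-elim (<⇒≱ k<a a≤k)
... | no  _   = refl

ascent-or-descent : ∀ {f : ℕ → ℕ} → (∀ {a b} → f a ≡ f b → a ≡ b) → ∀ c → f c < f (suc c) ⊎ f (suc c) < f c
ascent-or-descent {f} f-injective c with <-cmp (f c) (f (suc c))
... | tri< lt _ _ = inj₁ lt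
... | tri≈ _ eq _ = ⊥-elim (<⇒≢ (n<1+n c) (f-injective eq))
... | tri> _ _ gt = inj₂ gt

pigeonhole : ∀ n (h : ℕ → ℕ) → (∀ {a b} → a ≤ n → b ≤ n → h a ≡ h b → a ≡ b) →
             ¬ (∀ {a} → a ≤ n → h a < n)
pigeonhole n h h-injective h<n = 1+n≰n (injective⇒≤ g-injective)
  where
  g : Fin (suc n) → Fin n
  g i = fromℕ< (h<n (m<1+n⇒m≤n (toℕ<n i)))
  g-injective : ∀ {i j} → g i ≡ g j → i ≡ j
  g-injective {i} {j} gi≡gj = toℕ-injective (h-injective (m<1+n⇒m≤n (toℕ<n i)) (m<1+n⇒m≤n (toℕ<n j))
    (trans (sym (toℕ-fromℕ< _)) (trans (cong toℕ gi≡gj) (toℕ-fromℕ< _))))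

fix-above⇒preserves : ∀ {f : ℕ → ℕ} {j} → (∀ {a b} → f a ≡ f b → a ≡ b) → (∀ {a} → j < a → f a ≡ a) →
                      Preserves f j
fix-above⇒preserves {f} {j} f-injective fix {a} a≤j =
  ≮⇒≥ (λ j<f-a → <⇒≱ j<f-a (subst (_≤ j) (sym (f-injective (fix j<f-a))) a≤j))

preserves⇒preservesBelow : ∀ {f k} → Preserves f k → PreservesBelow f (suc k)
preserves⇒preservesBelow pres a<1+k = s≤s (pres (m<1+n⇒m≤n a<1+k))

preservesBelow⇒preserves : ∀ {f k} → PreservesBelow f (suc k) → Preserves f k
preservesBelow⇒preserves below a≤k = m<1+n⇒m≤n (below (s≤s a≤k))

cross-cong : ∀ {j f g} → (∀ a → f a ≡ g a) → Cross j f → Cross j g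
cross-cong {j} f≗g (a , a≤j , j<f-a) = a , a≤j , subst (j <_) (f≗g a) j<f-a

cross? : ∀ j f → Dec (Cross j f)
cross? j f = map′ (λ (a , a<1+j , j<fa) → a , m<1+n⇒m≤n a<1+j , j<fa) (λ (a , a≤j , j<fa) → a , s≤s a≤j , j<fa)
                  (anyUpTo? (λ a → j <? f a) (suc j))

¬cross⇒preserves : ∀ {j f} → ¬ Cross j f → Preserves f j
¬cross⇒preserves ¬cross {a} a≤j = ≮⇒≥ (λ j<fa → ¬cross (a , a≤j , j<fa))

preserves⇒¬cross : ∀ {j f} → Preserves f j → ¬ Cross j f
preserves⇒¬cross pres (a , a≤j , j<fa) = <⇒≱ j<fa (pres a≤j)

τ-preserves : ∀ {c j} → c ≢ j → Preserves (τ c) j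
τ-preserves {c} {j} c≢j {a} a≤j with τ-view c a
... | at-c a≡c τ≡       = subst (_≤ j) (sym τ≡) (≤∧≢⇒< (subst (_≤ j) a≡c a≤j) c≢j)
... | at-suc-c a≡1+c τ≡ = subst (_≤ j) (sym τ≡) (≤-trans (n≤1+n c) (subst (_≤ j) a≡1+c a≤j))
... | fixed _ _ τ≡      = subst (_≤ j) (sym τ≡) a≤j

module Symmetric (m : ℕ) where

  N : ℕ
  N = suc m

  ℓ : (ℕ → ℕ) → ℕ
  ℓ f = ∑∑ N (λ a b → [ a < b ] * [ f b < f a ])

  ℓ-cong : ∀ {f g} → (∀ {a} → a < N → f a ≡ g a) → ℓ f ≡ ℓ g
  ℓ-cong f≗g = ∑-cong N (λ {a} a<N → ∑-cong N (λ {b} b<N →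
    cong₂ (λ x y → [ a < b ] * [ x < y ]) (f≗g b<N) (f≗g a<N)))

  ℓ-id : ℓ id ≡ 0
  ℓ-id = ∑-zero N (λ {a} _ → ∑-zero N (λ {b} _ → [<]-asym a b))

  record Perm : Set where
    field
      to from : ℕ → ℕ
      from-to : ∀ a → from (to a) ≡ a
      to-from : ∀ a → to (from a) ≡ a
      to-fix  : ∀ {a} → N ≤ a → to a ≡ a

    to-injective : ∀ {a b} → to a ≡ to b → a ≡ b
    to-injective {a} {b} eq = trans (sym (from-to a)) (trans (cong from eq) (from-to b))

    from-injective : ∀ {a b} → from a ≡ from b → a ≡ b
    from-injective {a} {b} eq = trans (sym (to-from a)) (trans (cong to eq) (to-from b))

    from-fix : ∀ {a} → N ≤ a → from a ≡ a
    from-fix {a} N≤a = trans (cong from (sym (to-fix N≤a))) (from-to a)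

    to-bounded : Preserves to m
    to-bounded = fix-above⇒preserves to-injective to-fix

    to-< : ∀ {a} → a < N → to a < N
    to-< a<N = s≤s (to-bounded (m<1+n⇒m≤n a<N))

    from-< : ∀ {a} → a < N → from a < N
    from-< a<N = s≤s (fix-above⇒preserves from-injective from-fix (m<1+n⇒m≤n a<N))

  module _ (π : Perm) where
    open Perm π

    -- Only the pair of positions from c, from (suc c) changes its relative order.
    ℓ-τ∘ : ∀ {c} → c < m → ℓ (τ c ∘ to) + [ from (suc c) < from c ] ≡ ℓ to + [ from c < from (suc c) ]
    ℓ-τ∘ {c} c<m = begin
      ℓ (τ c ∘ to) + [ Q < P ]     ≡⟨ cong (_+ [ Q < P ]) (+-identityʳ _) ⟨
      ℓ (τ c ∘ to) + 0 + [ Q < P ] ≡⟨ cong₂ (λ x y → ℓ (τ c ∘ to) + x + y) H-PQ H-QP ⟨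
      ℓ (τ c ∘ to) + H P Q + H Q P ≡⟨ ∑∑-update₂ N H H′ (from-< c<N) (from-< (s≤s c<m)) P≢Q agree ⟩
      ℓ to + H′ P Q + H′ Q P       ≡⟨ cong₂ (λ x y → ℓ to + x + y) H′-PQ H′-QP ⟩
      ℓ to + [ P < Q ] + 0         ≡⟨ +-identityʳ _ ⟩
      ℓ to + [ P < Q ]             ∎
      where
      c<N : c < N
      c<N = m<n⇒m<1+n c<m
      P Q : ℕ
      P = from c
      Q = from (suc c)
      H H′ : ℕ → ℕ → ℕ
      H  a b = [ a < b ] * [ to b < to a ]
      H′ a b = [ a < b ] * [ τ c (to b) < τ c (to a) ]
      P≢Q : P ≢ Q
      P≢Q eq = <⇒≢ (n<1+n c) (from-injective eq)
      ≡from : ∀ {a x} → to a ≡ x → a ≡ from x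
      ≡from {a} refl = sym (from-to a)
      agree : ∀ {a b} → a < N → b < N → ¬ (a ≡ P × b ≡ Q) → ¬ (a ≡ Q × b ≡ P) → H′ a b ≡ H a b
      agree {a} {b} _ _ ¬PQ ¬QP = cong ([ a < b ] *_) ([<]-τ c (to b) (to a)
        (λ (e₁ , e₂) → ¬QP (≡from e₂ , ≡from e₁)) (λ (e₁ , e₂) → ¬PQ (≡from e₂ , ≡from e₁)))
      H-PQ : H P Q ≡ 0
      H-PQ = trans (cong₂ (λ x y → [ P < Q ] * [ x < y ]) (to-from (suc c)) (to-from c)) (*[<]-no [ P < Q ] (n≤1+n c))
      H-QP : H Q P ≡ [ Q < P ]
      H-QP = trans (cong₂ (λ x y → [ Q < P ] * [ x < y ]) (to-from c) (to-from (suc c))) (*[<]-yes _ (n<1+n c))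
      H′-PQ : H′ P Q ≡ [ P < Q ]
      H′-PQ = trans (cong₂ (λ x y → [ P < Q ] * [ τ c x < τ c y ]) (to-from (suc c)) (to-from c))
                (trans (cong₂ (λ x y → [ P < Q ] * [ x < y ]) (τ-at-suc c) (τ-at c)) (*[<]-yes _ (n<1+n c)))
      H′-QP : H′ Q P ≡ 0
      H′-QP = trans (cong₂ (λ x y → [ Q < P ] * [ τ c x < τ c y ]) (to-from c) (to-from (suc c)))
                (trans (cong₂ (λ x y → [ Q < P ] * [ x < y ]) (τ-at c) (τ-at-suc c)) (*[<]-no [ Q < P ] (n≤1+n c)))

    ℓ-τ∘-ascent : ∀ {c} → c < m → from c < from (suc c) → ℓ (τ c ∘ to) ≡ suc (ℓ to)
    ℓ-τ∘-ascent c<m = [<]-step-up (ℓ-τ∘ c<m)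

    ℓ-τ∘-descent : ∀ {c} → c < m → from (suc c) < from c → suc (ℓ (τ c ∘ to)) ≡ ℓ to
    ℓ-τ∘-descent c<m = [<]-step-down (ℓ-τ∘ c<m)

    from-ascent-or-descent : ∀ c → from c < from (suc c) ⊎ from (suc c) < from c
    from-ascent-or-descent = ascent-or-descent from-injective

    to-ascent-or-descent : ∀ c → to c < to (suc c) ⊎ to (suc c) < to c
    to-ascent-or-descent = ascent-or-descent to-injective

  -- Reindexing by τ c, only the pair of positions c, suc c changes its relative order.
  ℓ-∘τ : ∀ f {c} → c < m → ℓ (f ∘ τ c) + [ f (suc c) < f c ] ≡ ℓ f + [ f c < f (suc c) ]
  ℓ-∘τ f {c} c<m = begin
    ℓ (f ∘ τ c) + [ f (suc c) < f c ]   ≡⟨ cong₂ _+_ reindex (+-identityʳ _) ⟨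
    ∑∑ N H′ + ([ f (suc c) < f c ] + 0) ≡⟨ +-assoc (∑∑ N H′) _ _ ⟨
    ∑∑ N H′ + [ f (suc c) < f c ] + 0   ≡⟨ cong₂ (λ x y → ∑∑ N H′ + x + y) H-PQ H-QP ⟨
    ∑∑ N H′ + H c (suc c) + H (suc c) c ≡⟨ ∑∑-update₂ N H H′ c<N (s≤s c<m) (<⇒≢ (n<1+n c)) agree ⟩
    ℓ f + H′ c (suc c) + H′ (suc c) c   ≡⟨ cong₂ (λ x y → ℓ f + x + y) H′-PQ H′-QP ⟩
    ℓ f + 0 + [ f c < f (suc c) ]       ≡⟨ cong (_+ [ f c < f (suc c) ]) (+-identityʳ _) ⟩
    ℓ f + [ f c < f (suc c) ]           ∎
    where
    c<N : c < N
    c<N = m<n⇒m<1+n c<m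
    H H′ : ℕ → ℕ → ℕ
    H  a b = [ a < b ] * [ f b < f a ]
    H′ a b = [ τ c a < τ c b ] * [ f b < f a ]
    reindex : ∑∑ N H′ ≡ ℓ (f ∘ τ c)
    reindex = trans (sym (∑∑-τ N (s≤s c<m) H′)) (∑-cong N (λ {a} _ → ∑-cong N (λ {b} _ →
      cong₂ (λ x y → [ x < y ] * [ f (τ c b) < f (τ c a) ]) (τ-involutive c a) (τ-involutive c b))))
    agree : ∀ {a b} → a < N → b < N → ¬ (a ≡ c × b ≡ suc c) → ¬ (a ≡ suc c × b ≡ c) → H′ a b ≡ H a b
    agree {a} {b} _ _ ¬PQ ¬QP = cong (_* [ f b < f a ]) ([<]-τ c a b ¬PQ ¬QP)
    H-PQ : H c (suc c) ≡ [ f (suc c) < f c ]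
    H-PQ = [<]*-yes _ (n<1+n c)
    H-QP : H (suc c) c ≡ 0
    H-QP = [<]*-no _ (n≤1+n c)
    H′-PQ : H′ c (suc c) ≡ 0
    H′-PQ = trans (cong₂ (λ x y → [ x < y ] * [ f (suc c) < f c ]) (τ-at c) (τ-at-suc c)) ([<]*-no _ (n≤1+n c))
    H′-QP : H′ (suc c) c ≡ [ f c < f (suc c) ]
    H′-QP = trans (cong₂ (λ x y → [ x < y ] * [ f c < f (suc c) ]) (τ-at-suc c) (τ-at c)) ([<]*-yes _ (n<1+n c))

  ℓ-∘τ-ascent : ∀ f {c} → c < m → f c < f (suc c) → ℓ (f ∘ τ c) ≡ suc (ℓ f)
  ℓ-∘τ-ascent f c<m = [<]-step-up (ℓ-∘τ f c<m)

  ℓ-∘τ-descent : ∀ f {c} → c < m → f (suc c) < f c → suc (ℓ (f ∘ τ c)) ≡ ℓ f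
  ℓ-∘τ-descent f c<m = [<]-step-down (ℓ-∘τ f c<m)

  _∘ᵖ_ : Perm → Perm → Perm
  π ∘ᵖ σ = record
    { to      = to π ∘ to σ
    ; from    = from σ ∘ from π
    ; from-to = λ a → trans (cong (from σ) (from-to π (to σ a))) (from-to σ a)
    ; to-from = λ a → trans (cong (to π) (to-from σ (from π a))) (to-from π a)
    ; to-fix  = λ N≤a → trans (cong (to π) (to-fix σ N≤a)) (to-fix π N≤a)
    }
    where open Perm

  idᵖ : Perm
  idᵖ = record { to = id ; from = id ; from-to = λ _ → refl ; to-from = λ _ → refl ; to-fix = λ _ → refl }

  _⁻¹ᵖ : Perm → Perm
  π ⁻¹ᵖ = record { to = from ; from = to ; from-to = to-from ; to-from = from-to ; to-fix = from-fix }
    where open Perm π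

  τᵖ : ∀ {c} → c < m → Perm
  τᵖ {c} c<m = record
    { to = τ c ; from = τ c ; from-to = τ-involutive c ; to-from = τ-involutive c
    ; to-fix = λ N≤a → τ-fix-above (<-≤-trans (s≤s c<m) N≤a) }

  ⟦_⟧ : Word m → ℕ → ℕ
  ⟦ [] ⟧    = id
  ⟦ c ∷ x ⟧ = τ (toℕ c) ∘ ⟦ x ⟧

  ⟦⟧-++ : ∀ x y a → ⟦ x ++ y ⟧ a ≡ ⟦ x ⟧ (⟦ y ⟧ a)
  ⟦⟧-++ []      y a = refl
  ⟦⟧-++ (c ∷ x) y a = cong (τ (toℕ c)) (⟦⟧-++ x y a)

  ⟦⟧-fix : ∀ x {a} → N ≤ a → ⟦ x ⟧ a ≡ a
  ⟦⟧-fix []      _   = refl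
  ⟦⟧-fix (c ∷ x) N≤a = trans (cong (τ (toℕ c)) (⟦⟧-fix x N≤a)) (τ-fix-above (<-≤-trans (s≤s (toℕ<n c)) N≤a))

  ⟦reverse⟧-inverseˡ : ∀ x a → ⟦ reverse x ⟧ (⟦ x ⟧ a) ≡ a
  ⟦reverse⟧-inverseˡ []      a = refl
  ⟦reverse⟧-inverseˡ (c ∷ x) a = begin
    ⟦ reverse (c ∷ x) ⟧ (τ (toℕ c) (⟦ x ⟧ a))       ≡⟨ cong (λ r → ⟦ r ⟧ (⟦ c ∷ x ⟧ a)) (unfold-reverse c x) ⟩
    ⟦ reverse x ++ c ∷ [] ⟧ (τ (toℕ c) (⟦ x ⟧ a))   ≡⟨ ⟦⟧-++ (reverse x) (c ∷ []) _ ⟩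
    ⟦ reverse x ⟧ (τ (toℕ c) (τ (toℕ c) (⟦ x ⟧ a))) ≡⟨ cong ⟦ reverse x ⟧ (τ-involutive (toℕ c) _) ⟩
    ⟦ reverse x ⟧ (⟦ x ⟧ a)                         ≡⟨ ⟦reverse⟧-inverseˡ x a ⟩
    a                                               ∎

  ⟦reverse⟧-inverseʳ : ∀ x a → ⟦ x ⟧ (⟦ reverse x ⟧ a) ≡ a
  ⟦reverse⟧-inverseʳ x a =
    subst (λ r → ⟦ r ⟧ (⟦ reverse x ⟧ a) ≡ a) (reverse-involutive x) (⟦reverse⟧-inverseˡ (reverse x) a)

  perm : Word m → Perm
  perm x = record
    { to = ⟦ x ⟧ ; from = ⟦ reverse x ⟧
    ; from-to = ⟦reverse⟧-inverseˡ x ; to-from = ⟦reverse⟧-inverseʳ x ; to-fix = ⟦⟧-fix x }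

  ℓ≤length : ∀ x → ℓ ⟦ x ⟧ ≤ length x
  ℓ≤length []      = ≤-reflexive ℓ-id
  ℓ≤length (c ∷ x) with from-ascent-or-descent (perm x) (toℕ c)
  ... | inj₁ asc  = ≤-trans (≤-reflexive (ℓ-τ∘-ascent (perm x) (toℕ<n c) asc)) (s≤s (ℓ≤length x))
  ... | inj₂ desc = ≤-trans (n≤1+n _)
        (≤-trans (≤-reflexive (ℓ-τ∘-descent (perm x) (toℕ<n c) desc)) (m≤n⇒m≤1+n (ℓ≤length x)))

  module _ (π : Perm) where
    open Perm π

    Increasing : Set
    Increasing = ∀ (c : Fin m) → from (toℕ c) < from (suc (toℕ c))

    increasing⇒≤from : Increasing → ∀ {a} → a < N → a ≤ from a
    increasing⇒≤from inc {zero}  _ = z≤n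
    increasing⇒≤from inc {suc a} (s≤s a<m) = ≤-<-trans (increasing⇒≤from inc (m<n⇒m<1+n a<m))
      (subst (λ c → from c < from (suc c)) (toℕ-fromℕ< a<m) (inc (fromℕ< a<m)))

    increasing⇒to≤ : Increasing → ∀ {a} → a < N → to a ≤ a
    increasing⇒to≤ inc {a} a<N = subst (to a ≤_) (from-to a) (increasing⇒≤from inc (to-< a<N))

    increasing⇒id : Increasing → ∀ a → from a ≡ a
    increasing⇒id inc a with a <? N
    ... | no  a≮N = from-fix (≮⇒≥ a≮N)
    ... | yes a<N = <-rec (λ a → a < N → from a ≡ a) step a a<N
      where
      step : ∀ a → (∀ {b} → b < a → b < N → from b ≡ b) → a < N → from a ≡ a
      step a ih a<N with m≤n⇒m<n∨m≡n (increasing⇒to≤ inc a<N)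
      ... | inj₁ to-a<a = ⊥-elim (<⇒≢ to-a<a (sym (trans (sym (from-to a)) (ih to-a<a (to-< a<N)))))
      ... | inj₂ to-a≡a = trans (cong from (sym to-a≡a)) (from-to a)

    Descent : Set
    Descent = ∃ λ (c : Fin m) → from (suc (toℕ c)) < from (toℕ c)

    descent? : Dec Descent
    descent? = any? (λ c → from (suc (toℕ c)) <? from (toℕ c))

    ¬descent⇒id : ¬ Descent → ∀ a → to a ≡ a
    ¬descent⇒id ¬desc a = trans (cong to (sym (increasing⇒id increasing a))) (to-from a)
      where
      increasing : Increasing
      increasing c with from-ascent-or-descent π (toℕ c)
      ... | inj₁ asc  = asc
      ... | inj₂ desc = ⊥-elim (¬desc (c , desc))

  word-of : ∀ n (π : Perm) → ℓ (Perm.to π) ≡ n →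
            Σ (Word m) λ r → (∀ a → ⟦ r ⟧ a ≡ Perm.to π a) × length r ≡ n
  word-of n π ℓ≡n with descent? π
  ... | no ¬desc = [] , (λ a → sym (¬descent⇒id π ¬desc a)) ,
        trans (sym ℓ-id) (trans (ℓ-cong (λ {a} _ → sym (¬descent⇒id π ¬desc a))) ℓ≡n)
  word-of zero    π ℓ≡0    | yes (c , desc) = ⊥-elim (1+n≢0 (trans (ℓ-τ∘-descent π (toℕ<n c) desc) ℓ≡0))
  word-of (suc n) π ℓ≡1+n  | yes (c , desc) with word-of n (τᵖ (toℕ<n c) ∘ᵖ π)
                                                   (suc-injective (trans (ℓ-τ∘-descent π (toℕ<n c) desc) ℓ≡1+n))
  ... | r , r≗ , length-r = c ∷ r ,
        (λ a → trans (cong (τ (toℕ c)) (r≗ a)) (τ-involutive (toℕ c) (Perm.to π a))) , cong suc length-r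

  module _ (π : Perm) where
    open Perm π

    -- If to q ≤ j, then to ∘ ι injects {0, …, j + 1} into {0, …, j}.
    preserves⇒preserves-above : ∀ {j} → Preserves to j → ∀ {q} → j < q → j < to q
    preserves⇒preserves-above {j} pres {q} j<q with j <? to q
    ... | yes j<to-q = j<to-q
    ... | no  j≮to-q = ⊥-elim (pigeonhole (suc j) (to ∘ ι) ι-injective ι-bounded)
      where
      ι : ℕ → ℕ
      ι = select j id (λ _ → q)
      ι≤j : ∀ {a} → a ≤ j → ι a ≡ a
      ι≤j = select-≤
      ι-top : ι (suc j) ≡ q
      ι-top = select-> (n<1+n j)
      low-or-top : ∀ {a} → a ≤ suc j → a ≤ j ⊎ a ≡ suc j
      low-or-top a≤1+j with m≤n⇒m<n∨m≡n a≤1+j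
      ... | inj₁ a<1+j = inj₁ (m<1+n⇒m≤n a<1+j)
      ... | inj₂ a≡1+j = inj₂ a≡1+j
      ι-injective : ∀ {a b} → a ≤ suc j → b ≤ suc j → to (ι a) ≡ to (ι b) → a ≡ b
      ι-injective a≤ b≤ eq with low-or-top a≤ | low-or-top b≤ | to-injective eq
      ... | inj₁ a≤j | inj₁ b≤j | ιa≡ιb = trans (sym (ι≤j a≤j)) (trans ιa≡ιb (ι≤j b≤j))
      ... | inj₁ a≤j | inj₂ refl | ιa≡ιb =
        ⊥-elim (<⇒≱ j<q (subst (_≤ j) (trans (sym (ι≤j a≤j)) (trans ιa≡ιb ι-top)) a≤j))
      ... | inj₂ refl | inj₁ b≤j | ιa≡ιb =
        ⊥-elim (<⇒≱ j<q (subst (_≤ j) (trans (sym (ι≤j b≤j)) (trans (sym ιa≡ιb) ι-top)) b≤j))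
      ... | inj₂ refl | inj₂ refl | _ = refl
      ι-bounded : ∀ {a} → a ≤ suc j → to (ι a) < suc j
      ι-bounded a≤ with low-or-top a≤
      ... | inj₁ a≤j  = s≤s (subst (λ b → to b ≤ j) (sym (ι≤j a≤j)) (pres a≤j))
      ... | inj₂ refl = s≤s (subst (λ b → to b ≤ j) (sym ι-top) (≮⇒≥ j≮to-q))

    preserves⇒from-preserves : ∀ {j} → Preserves to j → Preserves from j
    preserves⇒from-preserves pres {c} c≤j = ≮⇒≥ (λ j<from-c →
      <⇒≱ (subst (_ <_) (to-from c) (preserves⇒preserves-above pres j<from-c)) c≤j)

    cross-τ∘ : ∀ {j c} → Cross j to → from c < from (suc c) → Cross j (τ c ∘ to)
    cross-τ∘ {j} {c} (a , a≤j , j<to-a) asc with τ-view c (to a)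
    ... | at-c to-a≡c τ≡ = a , a≤j , subst (j <_) (sym τ≡) (m<n⇒m<1+n (subst (j <_) to-a≡c j<to-a))
    ... | fixed _ _ τ≡   = a , a≤j , subst (j <_) (sym τ≡) j<to-a
    ... | at-suc-c to-a≡1+c τ≡ with c ≟ j
    ...   | no c≢j  = a , a≤j , subst (j <_) (sym τ≡)
                        (≤∧≢⇒< (m<1+n⇒m≤n (subst (j <_) to-a≡1+c j<to-a)) (c≢j ∘ sym))
    ...   | yes refl = from c , ≤-trans (<⇒≤ (<-≤-trans asc (≤-reflexive from-1+c≡a))) a≤j ,
                       subst (c <_) (sym (trans (cong (τ c) (to-from c)) (τ-at c))) (n<1+n c)
      where
      from-1+c≡a : from (suc c) ≡ a
      from-1+c≡a = trans (cong from (sym to-a≡1+c)) (from-to a)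

    cross-τ∘-self : ∀ {j} → from j < from (suc j) → Cross j (τ j ∘ to)
    cross-τ∘-self {j} asc with from j ≤? j
    ... | yes from-j≤j = from j , from-j≤j , subst (j <_) (sym (trans (cong (τ j) (to-from j)) (τ-at j))) (n<1+n j)
    ... | no  from-j≰j with cross? j to
    ...   | yes cross = cross-τ∘ cross asc
    ...   | no ¬cross = ⊥-elim (from-j≰j (preserves⇒from-preserves (¬cross⇒preserves ¬cross) ≤-refl))

    preservesBelow⇒above : ∀ {i} → PreservesBelow to i → ∀ {q} → i ≤ q → i ≤ to q
    preservesBelow⇒above {zero}  _    _     = z≤n
    preservesBelow⇒above {suc i} below i<q = preserves⇒preserves-above (preservesBelow⇒preserves below) i<q

    preservesBelow⇒from : ∀ {i} → PreservesBelow to i → PreservesBelow from i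
    preservesBelow⇒from {suc i} below = preserves⇒preservesBelow (preserves⇒from-preserves (preservesBelow⇒preserves below))

  cross-of-letter : ∀ u {s} → ℓ ⟦ u ⟧ ≡ length u → s ∈ u → Cross (toℕ s) ⟦ u ⟧
  cross-of-letter (c ∷ x) tight s∈u with from-ascent-or-descent (perm x) (toℕ c)
  ... | inj₂ desc = ⊥-elim (1+n≰n (≤-trans (n≤1+n _) (subst (_≤ length x)
          (sym (trans (cong suc (sym tight)) (ℓ-τ∘-descent (perm x) (toℕ<n c) desc))) (ℓ≤length x))))
  ... | inj₁ asc with s∈u
  ...   | here refl  = cross-τ∘-self (perm x) asc
  ...   | there s∈x = cross-τ∘ (perm x) (cross-of-letter x tight-x s∈x) asc
    where
    tight-x : ℓ ⟦ x ⟧ ≡ length x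
    tight-x = suc-injective (trans (sym (ℓ-τ∘-ascent (perm x) (toℕ<n c) asc)) tight)

  avoids⇒preserves : ∀ x {s} → All (s ≢_) x → Preserves ⟦ x ⟧ (toℕ s)
  avoids⇒preserves []      _              a≤s = a≤s
  avoids⇒preserves (c ∷ x) (s≢c ∷ avoids) a≤s =
    τ-preserves (λ c≡s → s≢c (toℕ-injective (sym c≡s))) (avoids⇒preserves x avoids a≤s)

  select-inverse : ∀ {k} (σ ρ : Perm) → Preserves (Perm.to σ) k → Preserves (Perm.to ρ) k →
    ∀ a → select k (Perm.from σ) (Perm.from ρ) (select k (Perm.to σ) (Perm.to ρ) a) ≡ a
  select-inverse {k} σ ρ σ-pres ρ-pres a with ≤-<-connex a k
  ... | inj₁ a≤k = trans (cong (select k _ _) (select-≤ a≤k)) (trans (select-≤ (σ-pres a≤k)) (Perm.from-to σ a))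
  ... | inj₂ k<a = trans (cong (select k _ _) (select-> k<a))
                     (trans (select-> (preserves⇒preserves-above ρ ρ-pres k<a)) (Perm.from-to ρ a))

  glue : ∀ k (σ ρ : Perm) → Preserves (Perm.to σ) k → Preserves (Perm.to ρ) k → Perm
  glue k σ ρ σ-pres ρ-pres = record
    { to = select k (to σ) (to ρ) ; from = select k (from σ) (from ρ)
    ; from-to = select-inverse σ ρ σ-pres ρ-pres
    ; to-from = select-inverse (σ ⁻¹ᵖ) (ρ ⁻¹ᵖ) (preserves⇒from-preserves σ σ-pres) (preserves⇒from-preserves ρ ρ-pres)
    ; to-fix  = select-fix }
    where
    open Perm
    select-fix : ∀ {a} → N ≤ a → select k (to σ) (to ρ) a ≡ a
    select-fix {a} N≤a with ≤-<-connex a k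
    ... | inj₁ a≤k = trans (select-≤ a≤k) (to-fix σ N≤a)
    ... | inj₂ k<a = trans (select-> k<a) (to-fix ρ N≤a)

  -- f = left ∘ right with left ∈ ⟨s₀, …, s_k⟩ and right ∈ ⟨s_{k+1}, …⟩.
  record Split (f : ℕ → ℕ) (k : ℕ) : Set where
    field
      left right : Word m
      left∘right : ∀ a → ⟦ left ⟧ (⟦ right ⟧ a) ≡ f a
      left-fix   : ∀ {a} → suc k < a → ⟦ left ⟧ a ≡ a
      right-fix  : ∀ {a} → a ≤ k → ⟦ right ⟧ a ≡ a

  split-preserving : ∀ {k} (π : Perm) → Preserves (Perm.to π) k → Split (Perm.to π) k
  split-preserving {k} π pres = record
    { left       = proj₁ L
    ; right      = proj₁ R
    ; left∘right = λ a → trans (cong ⟦ proj₁ L ⟧ (proj₁ (proj₂ R) a)) (trans (proj₁ (proj₂ L) _) (low∘high a))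
    ; left-fix   = λ 1+k<a → trans (proj₁ (proj₂ L) _) (select-> (<-trans (n<1+n k) 1+k<a))
    ; right-fix  = λ a≤k → trans (proj₁ (proj₂ R) _) (select-≤ a≤k)
    }
    where
    open Perm π
    low high : Perm
    low  = glue k π idᵖ pres (λ a≤k → a≤k)
    high = glue k idᵖ π (λ a≤k → a≤k) pres
    L : Σ (Word m) λ r → (∀ a → ⟦ r ⟧ a ≡ Perm.to low a) × length r ≡ ℓ (Perm.to low)
    L = word-of _ low refl
    R : Σ (Word m) λ r → (∀ a → ⟦ r ⟧ a ≡ Perm.to high a) × length r ≡ ℓ (Perm.to high)
    R = word-of _ high refl
    low∘high : ∀ a → select k to id (select k id to a) ≡ to a
    low∘high a with ≤-<-connex a k
    ... | inj₁ a≤k = trans (cong (select k to id) (select-≤ a≤k)) (select-≤ a≤k)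
    ... | inj₂ k<a = trans (cong (select k to id) (select-> k<a)) (select-> (preserves⇒preserves-above π pres k<a))

  -- c ≤ k + 1 is the value missed by π on {0, …, k}; composing with τ c moves it up to c + 1.
  split-missing : ∀ d {k c} → k < m → c + d ≡ suc k → (π : Perm) → AlmostPreserves (Perm.to π) k →
                  (∀ {a} → a ≤ k → Perm.to π a ≢ c) → Split (Perm.to π) k
  split-missing zero {k} {c} _ c+0≡1+k π almost missing =
    split-preserving π (λ a≤k → m<1+n⇒m≤n (≤∧≢⇒< (almost a≤k) (λ eq → missing a≤k (trans eq (sym c≡1+k)))))
    where
    c≡1+k : c ≡ suc k
    c≡1+k = trans (sym (+-identityʳ c)) c+0≡1+k
  split-missing (suc d) {k} {c} k<m c+1+d≡1+k π almost missing = record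
    { left       = fromℕ< c<m ∷ left
    ; right      = right
    ; left∘right = λ a → trans (τ-letter _) (trans (cong (τ c) (left∘right a)) (τ-involutive c (to a)))
    ; left-fix   = λ 1+k<a → trans (τ-letter _) (trans (cong (τ c) (left-fix 1+k<a)) (τ-fix-above (≤-<-trans (s≤s c≤k) 1+k<a)))
    ; right-fix  = right-fix
    }
    where
    open Perm π
    c+d≡k : c + d ≡ k
    c+d≡k = suc-injective (trans (sym (+-suc c d)) c+1+d≡1+k)
    c≤k : c ≤ k
    c≤k = subst (c ≤_) c+d≡k (m≤m+n c d)
    c<m : c < m
    c<m = ≤-<-trans c≤k k<m
    τ-letter : ∀ a → τ (toℕ (fromℕ< c<m)) a ≡ τ c a
    τ-letter a = cong (λ j → τ j a) (toℕ-fromℕ< c<m)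
    open Split (split-missing d k<m (cong suc c+d≡k) (τᵖ c<m ∘ᵖ π)
      (λ a≤k → τ-preserves (<⇒≢ (s≤s c≤k)) (almost a≤k))
      (λ {a} a≤k eq → missing a≤k (trans (sym (τ-involutive c (to a))) (trans (cong (τ c) eq) (τ-at-suc c)))))

  module _ {k} (k<m : k < m) (π : Perm) (almost : AlmostPreserves (Perm.to π) k) where
    open Perm π

    split-almost-preserving : Split to k
    split-almost-preserving with anyUpTo? (λ c → k <? from c) (suc (suc k))
    ... | no ¬escape = ⊥-elim (pigeonhole (suc k) from (λ _ _ → from-injective)
            (λ {c} c≤1+k → s≤s (≮⇒≥ (λ k<from-c → ¬escape (c , s≤s c≤1+k , k<from-c)))))
    ... | yes (c , s≤s c≤1+k , k<from-c) = split-missing (suc k ∸ c) k<m (m+[n∸m]≡n c≤1+k) π almost missing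
      where
      missing : ∀ {a} → a ≤ k → to a ≢ c
      missing {a} a≤k to-a≡c = <⇒≱ k<from-c (subst (_≤ k) (trans (sym (from-to a)) (cong from to-a≡c)) a≤k)

  Splits : Perm → Set
  Splits π = ∃ λ k → suc k < m × (AlmostPreserves (Perm.to π) k ⊎ AlmostPreserves (Perm.from π) k)

  -- Lengths, supports and descents of words

  toℕ-swapAt : ∀ (i : Fin m) k → toℕ (swapAt i k) ≡ τ (toℕ i) (toℕ k)
  toℕ-swapAt i k with k ≟ᶠ inject₁ i
  ... | yes refl = sym (trans (cong (τ (toℕ i)) (toℕ-inject₁ i)) (τ-at (toℕ i)))
  ... | no k≢i with k ≟ᶠ fsuc i
  ...   | yes refl = trans (toℕ-inject₁ i) (sym (τ-at-suc (toℕ i)))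
  ...   | no k≢1+i = sym (τ-fix (λ eq → k≢i (toℕ-injective (trans eq (sym (toℕ-inject₁ i)))))
                                (λ eq → k≢1+i (toℕ-injective eq)))

  toℕ-eval : ∀ x k → toℕ (eval x k) ≡ ⟦ x ⟧ (toℕ k)
  toℕ-eval []      k = refl
  toℕ-eval (c ∷ x) k = trans (toℕ-swapAt c (eval x k)) (cong (τ (toℕ c)) (toℕ-eval x k))

  ≈⇒≗ : ∀ {x y} → x ≈ y → ∀ a → ⟦ x ⟧ a ≡ ⟦ y ⟧ a
  ≈⇒≗ {x} {y} x≈y a with a <? N
  ... | no  a≮N = trans (⟦⟧-fix x (≮⇒≥ a≮N)) (sym (⟦⟧-fix y (≮⇒≥ a≮N)))
  ... | yes a<N = begin
    ⟦ x ⟧ a                   ≡⟨ cong ⟦ x ⟧ (toℕ-fromℕ< a<N) ⟨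
    ⟦ x ⟧ (toℕ (fromℕ< a<N))  ≡⟨ toℕ-eval x _ ⟨
    toℕ (eval x (fromℕ< a<N)) ≡⟨ cong toℕ (x≈y _) ⟩
    toℕ (eval y (fromℕ< a<N)) ≡⟨ toℕ-eval y _ ⟩
    ⟦ y ⟧ (toℕ (fromℕ< a<N))  ≡⟨ cong ⟦ y ⟧ (toℕ-fromℕ< a<N) ⟩
    ⟦ y ⟧ a                   ∎

  ≗⇒≈ : ∀ {x y} → (∀ a → ⟦ x ⟧ a ≡ ⟦ y ⟧ a) → x ≈ y
  ≗⇒≈ {x} {y} x≗y k = toℕ-injective (trans (toℕ-eval x k) (trans (x≗y (toℕ k)) (sym (toℕ-eval y k))))

  ℓ-≈ : ∀ {x y} → x ≈ y → ℓ ⟦ x ⟧ ≡ ℓ ⟦ y ⟧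
  ℓ-≈ {x} {y} x≈y = ℓ-cong (λ {a} _ → ≈⇒≗ {x} {y} x≈y a)

  reduced-word : ∀ x → Σ (Word m) λ r → Reduced r x × length r ≡ ℓ ⟦ x ⟧
  reduced-word x with word-of (ℓ ⟦ x ⟧) (perm x) refl
  ... | r , r≗x , length-r = r , (≗⇒≈ {r} {x} r≗x , shortest) , length-r
    where
    shortest : ∀ y → y ≈ x → length r ≤ length y
    shortest y y≈x = subst (_≤ length y) (trans (ℓ-≈ {y} {x} y≈x) (sym length-r)) (ℓ≤length y)

  reduced-length : ∀ {u x} → Reduced u x → length u ≡ ℓ ⟦ x ⟧
  reduced-length {u} {x} (u≈x , shortest) with reduced-word x
  ... | r , r-reduced , length-r = ≤-antisym (subst (length u ≤_) length-r (shortest r (proj₁ r-reduced)))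
                                              (subst (_≤ length u) (ℓ-≈ {u} {x} u≈x) (ℓ≤length u))

  Len-ℓ : ∀ x → Len x (ℓ ⟦ x ⟧)
  Len-ℓ x = let r , r-reduced , length-r = reduced-word x in r , r-reduced , length-r

  Len⇒≡ℓ : ∀ {x k} → Len x k → k ≡ ℓ ⟦ x ⟧
  Len⇒≡ℓ {x} (u , u-reduced , length-u) = trans (sym length-u) (reduced-length {u} {x} u-reduced)

  ∈supp⇒cross : ∀ {s x} → s ∈supp x → Cross (toℕ s) ⟦ x ⟧
  ∈supp⇒cross {s} {x} (u , u-reduced@(u≈x , _) , s∈u) = cross-cong (≈⇒≗ {u} {x} u≈x)
    (cross-of-letter u (trans (ℓ-≈ {u} {x} u≈x) (sym (reduced-length {u} {x} u-reduced))) s∈u)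

  open import Data.List.Membership.DecPropositional (_≟ᶠ_ {m}) using () renaming (_∈?_ to _∈ᶠ?_)

  ∉supp⇒preserves : ∀ {s x} → ¬ s ∈supp x → Preserves ⟦ x ⟧ (toℕ s)
  ∉supp⇒preserves {s} {x} s∉supp {a} a≤s with reduced-word x
  ... | r , r-reduced@(r≈x , _) , _ with s ∈ᶠ? r
  ...   | yes s∈r = ⊥-elim (s∉supp (r , r-reduced , s∈r))
  ...   | no  s∉r = subst (_≤ toℕ s) (≈⇒≗ {r} {x} r≈x a) (avoids⇒preserves r (¬Any⇒All¬ r s∉r) a≤s)

  DL⇒descent : ∀ {x s} → DL x s → ⟦ reverse x ⟧ (suc (toℕ s)) < ⟦ reverse x ⟧ (toℕ s)
  DL⇒descent {x} {s} (k , k′ , len-sx , len-x , k<k′) with from-ascent-or-descent (perm x) (toℕ s)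
  ... | inj₂ desc = desc
  ... | inj₁ asc  = ⊥-elim (<-asym k<k′ (subst (k′ <_) (sym k≡1+k′) (n<1+n k′)))
    where
    k≡1+k′ : k ≡ suc k′
    k≡1+k′ = trans (Len⇒≡ℓ {s ∷ x} len-sx)
               (trans (ℓ-τ∘-ascent (perm x) (toℕ<n s) asc) (cong suc (sym (Len⇒≡ℓ {x} len-x))))

  ℓ-snoc : ∀ x s → ℓ ⟦ x ++ s ∷ [] ⟧ ≡ ℓ (⟦ x ⟧ ∘ τ (toℕ s))
  ℓ-snoc x s = ℓ-cong (λ {a} _ → ⟦⟧-++ x (s ∷ []) a)

  DR⇒descent : ∀ {x s} → DR x s → ⟦ x ⟧ (suc (toℕ s)) < ⟦ x ⟧ (toℕ s)
  DR⇒descent {x} {s} (k , k′ , len-xs , len-x , k<k′) with to-ascent-or-descent (perm x) (toℕ s)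
  ... | inj₂ desc = desc
  ... | inj₁ asc  = ⊥-elim (<-asym k<k′ (subst (k′ <_) (sym k≡1+k′) (n<1+n k′)))
    where
    k≡1+k′ : k ≡ suc k′
    k≡1+k′ = trans (Len⇒≡ℓ {x ++ s ∷ []} len-xs) (trans (ℓ-snoc x s)
               (trans (ℓ-∘τ-ascent ⟦ x ⟧ (toℕ<n s) asc) (cong suc (sym (Len⇒≡ℓ {x} len-x)))))

  ¬DR⇒ascent : ∀ {x s} → ¬ DR x s → ⟦ x ⟧ (toℕ s) < ⟦ x ⟧ (suc (toℕ s))
  ¬DR⇒ascent {x} {s} ¬DR with to-ascent-or-descent (perm x) (toℕ s)
  ... | inj₁ asc  = asc
  ... | inj₂ desc = ⊥-elim (¬DR (_ , _ , Len-ℓ (x ++ s ∷ []) , Len-ℓ x ,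
          subst (λ n → suc n ≤ ℓ ⟦ x ⟧) (sym (ℓ-snoc x s)) (≤-reflexive (ℓ-∘τ-descent ⟦ x ⟧ (toℕ<n s) desc))))

  parabolic⇒preserves : ∀ {J v c} → InParabolic J v → ¬ (c ∈ˢ J) → Preserves ⟦ v ⟧ (toℕ c)
  parabolic⇒preserves {J} {v} {c} (z , z≈v , z⊆J) c∉J {a} a≤c =
    subst (_≤ toℕ c) (≈⇒≗ {z} {v} z≈v a)
      (avoids⇒preserves z (All.map (λ d∈J c≡d → c∉J (subst (_∈ˢ J) (sym c≡d) d∈J)) z⊆J) a≤c)

  minCoset⇒ascent : ∀ {J w u i} → MinInCoset J w u → i ∈ˢ J → ⟦ u ⟧ (toℕ i) < ⟦ u ⟧ (suc (toℕ i))
  minCoset⇒ascent {J} {w} {u} {i} ((y , (z , z≈y , z⊆J) , u≈wy) , shortest) i∈J with to-ascent-or-descent (perm u) (toℕ i)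
  ... | inj₁ asc  = asc
  ... | inj₂ desc = ⊥-elim (1+n≰n (subst (suc (ℓ (⟦ u ⟧ ∘ τ (toℕ i))) ≤_) w-y′≡
          (subst (_≤ ℓ ⟦ w ++ y′ ⟧) (sym (ℓ-∘τ-descent ⟦ u ⟧ (toℕ<n i) desc))
            (shortest y′ y′∈W_J _ _ (Len-ℓ u) (Len-ℓ (w ++ y′))))))
    where
    y′ : Word _
    y′ = y ++ i ∷ []
    y′∈W_J : InParabolic J y′
    y′∈W_J = z ++ i ∷ [] , ≗⇒≈ {z ++ i ∷ []} {y′} (λ a → trans (⟦⟧-++ z (i ∷ []) a)
               (trans (≈⇒≗ {z} {y} z≈y _) (sym (⟦⟧-++ y (i ∷ []) a)))) , ++⁺ z⊆J (i∈J ∷ [])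
    w-y′≡ : ℓ ⟦ w ++ y′ ⟧ ≡ ℓ (⟦ u ⟧ ∘ τ (toℕ i))
    w-y′≡ = ℓ-cong λ {a} _ → begin
      ⟦ w ++ y′ ⟧ a               ≡⟨ ⟦⟧-++ w y′ a ⟩
      ⟦ w ⟧ (⟦ y ++ i ∷ [] ⟧ a)   ≡⟨ cong ⟦ w ⟧ (⟦⟧-++ y (i ∷ []) a) ⟩
      ⟦ w ⟧ (⟦ y ⟧ (τ (toℕ i) a)) ≡⟨ ⟦⟧-++ w y _ ⟨
      ⟦ w ++ y ⟧ (τ (toℕ i) a)    ≡⟨ ≈⇒≗ {u} {w ++ y} u≈wy _ ⟨
      ⟦ u ⟧ (τ (toℕ i) a)         ∎

  BruhatReducible : Word m → Set
  BruhatReducible w = Σ _ λ w′ → Σ _ λ w″ → w ≈ (w′ ++ w″) × ¬ IsId w′ × ¬ IsId w″ ×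
                        (∀ s → s ∈supp w′ → s ∈supp w″ → ⊥)

  full-support⇒cross : ∀ {w} → (∀ s → s ∈supp w) → ∀ {j} → j < m → Cross j ⟦ w ⟧
  full-support⇒cross {w} full j<m =
    subst (λ j → Cross j ⟦ w ⟧) (toℕ-fromℕ< j<m) (∈supp⇒cross {x = w} (full (fromℕ< j<m)))

  identity-factor : ∀ {w x y} → IsId x → w ≈ (x ++ y) ⊎ w ≈ (y ++ x) → ∀ a → ⟦ w ⟧ a ≡ ⟦ y ⟧ a
  identity-factor {w} {x} {y} x≈id (inj₁ w≈xy) a =
    trans (≈⇒≗ {w} {x ++ y} w≈xy a) (trans (⟦⟧-++ x y a) (≈⇒≗ {x} {[]} x≈id _))
  identity-factor {w} {x} {y} x≈id (inj₂ w≈yx) a =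
    trans (≈⇒≗ {w} {y ++ x} w≈yx a) (trans (⟦⟧-++ y x a) (cong ⟦ y ⟧ (≈⇒≗ {x} {[]} x≈id a)))

  module _ {k} (P Q : Word m)
           (P-fix : ∀ {a} → suc k < a → ⟦ P ⟧ a ≡ a) (Q-fix : ∀ {a} → a ≤ k → ⟦ Q ⟧ a ≡ a) where

    supp-low : ∀ {s} → s ∈supp P → toℕ s ≤ k
    supp-low {s} s∈P = ≮⇒≥ (λ k<s →
      preserves⇒¬cross (fix-above⇒preserves (Perm.to-injective (perm P)) (λ s<a → P-fix (≤-<-trans k<s s<a)))
                       (∈supp⇒cross {s} {P} s∈P))

    supp-high : ∀ {s} → s ∈supp Q → k < toℕ s
    supp-high {s} s∈Q = ≰⇒> (λ s≤k →
      preserves⇒¬cross (λ a≤s → subst (_≤ toℕ s) (sym (Q-fix (≤-trans a≤s s≤k))) a≤s) (∈supp⇒cross {s} {Q} s∈Q))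

    disjoint : ∀ s → s ∈supp P → s ∈supp Q → ⊥
    disjoint s s∈P s∈Q = <⇒≱ (supp-high s∈Q) (supp-low s∈P)

    factorisation⇒reducible : ∀ w → Cross k ⟦ w ⟧ → Cross (suc k) ⟦ w ⟧ →
                              w ≈ (P ++ Q) ⊎ w ≈ (Q ++ P) → BruhatReducible w
    factorisation⇒reducible w cross-k cross-1+k order = reduction order
      where
      P≉id : ¬ IsId P
      P≉id P≈id = preserves⇒¬cross (λ {a} a≤k →
        subst (_≤ k) (sym (trans (identity-factor {w} {P} {Q} P≈id order a) (Q-fix a≤k))) a≤k) cross-k
      Q≉id : ¬ IsId Q
      Q≉id Q≈id = preserves⇒¬cross (λ {a} a≤1+k → subst (_≤ suc k) (sym (identity-factor {w} {Q} {P} Q≈id (Sum.swap order) a))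
                    (fix-above⇒preserves (Perm.to-injective (perm P)) P-fix a≤1+k)) cross-1+k
      reduction : w ≈ (P ++ Q) ⊎ w ≈ (Q ++ P) → BruhatReducible w
      reduction (inj₁ w≈PQ) = P , Q , w≈PQ , P≉id , Q≉id , disjoint
      reduction (inj₂ w≈QP) = Q , P , w≈QP , Q≉id , P≉id , λ s s∈Q s∈P → disjoint s s∈P s∈Q

  irreducible⇒¬splits : ∀ w → BruhatIrreducible w → ¬ Splits (perm w)
  irreducible⇒¬splits w (full , irreducible) (k , 1+k<m , inj₁ almost) =
    irreducible (factorisation⇒reducible left right left-fix right-fix w
                   (full-support⇒cross {w} full k<m) (full-support⇒cross {w} full 1+k<m) (inj₁ w≈left-right))
    where
    k<m : k < m
    k<m = <-trans (n<1+n k) 1+k<m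
    open Split (split-almost-preserving k<m (perm w) almost)
    w≈left-right : w ≈ (left ++ right)
    w≈left-right = ≗⇒≈ {w} {left ++ right} (λ a → sym (trans (⟦⟧-++ left right a) (left∘right a)))
  irreducible⇒¬splits w (full , irreducible) (k , 1+k<m , inj₂ almost) =
    irreducible (factorisation⇒reducible (reverse left) (reverse right) left⁻¹-fix right⁻¹-fix w
                   (full-support⇒cross {w} full k<m) (full-support⇒cross {w} full 1+k<m) (inj₂ w≈right⁻¹-left⁻¹))
    where
    k<m : k < m
    k<m = <-trans (n<1+n k) 1+k<m
    open Split (split-almost-preserving k<m (perm w ⁻¹ᵖ) almost)
    left⁻¹-fix : ∀ {a} → suc k < a → ⟦ reverse left ⟧ a ≡ a
    left⁻¹-fix {a} 1+k<a = trans (cong ⟦ reverse left ⟧ (sym (left-fix 1+k<a))) (⟦reverse⟧-inverseˡ left a)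
    right⁻¹-fix : ∀ {a} → a ≤ k → ⟦ reverse right ⟧ a ≡ a
    right⁻¹-fix {a} a≤k = trans (cong ⟦ reverse right ⟧ (sym (right-fix a≤k))) (⟦reverse⟧-inverseˡ right a)
    w⁻¹-inverse : ∀ a → ⟦ reverse w ⟧ (⟦ reverse right ⟧ (⟦ reverse left ⟧ a)) ≡ a
    w⁻¹-inverse a = trans (sym (left∘right _))
      (trans (cong ⟦ left ⟧ (⟦reverse⟧-inverseʳ right _)) (⟦reverse⟧-inverseʳ left a))
    w≈right⁻¹-left⁻¹ : w ≈ (reverse right ++ reverse left)
    w≈right⁻¹-left⁻¹ = ≗⇒≈ {w} {reverse right ++ reverse left} λ a → begin
      ⟦ w ⟧ a                                                        ≡⟨ cong ⟦ w ⟧ (w⁻¹-inverse a) ⟨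
      ⟦ w ⟧ (⟦ reverse w ⟧ (⟦ reverse right ⟧ (⟦ reverse left ⟧ a))) ≡⟨ ⟦reverse⟧-inverseʳ w _ ⟩
      ⟦ reverse right ⟧ (⟦ reverse left ⟧ a)                         ≡⟨ ⟦⟧-++ (reverse right) (reverse left) a ⟨
      ⟦ reverse right ++ reverse left ⟧ a                            ∎

  -- Adjacent descents of an almost reducible element

  -- U, V, W stand for u = w^J, v = w_J and w: s_i ∉ D_R(u) since u is minimal in its coset,
  -- s_i ∈ supp(u), s_i ∈ D_L(v) by the Billey–Postnikov condition, and s_i ∉ D_R(w).
  module AdjacentDescent
    (U V W : Perm) (W≗UV : ∀ a → Perm.to W a ≡ Perm.to U (Perm.to V a)) {i : ℕ} (i<m : i < m)
    (U-asc   : Perm.to U i < Perm.to U (suc i))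
    (U-cross : Cross i (Perm.to U))
    (V-desc  : Perm.from V (suc i) < Perm.from V i)
    (W-asc   : Perm.to W i < Perm.to W (suc i))
    where

    u u⁻¹ v v⁻¹ w w⁻¹ : ℕ → ℕ
    u = Perm.to U
    u⁻¹ = Perm.from U
    v = Perm.to V
    v⁻¹ = Perm.from V
    w = Perm.to W
    w⁻¹ = Perm.from W

    w⁻¹≗ : ∀ a → w⁻¹ a ≡ v⁻¹ (u⁻¹ a)
    w⁻¹≗ a = Perm.to-injective W (begin
      w (w⁻¹ a)           ≡⟨ Perm.to-from W a ⟩
      a                   ≡⟨ Perm.to-from U a ⟨
      u (u⁻¹ a)           ≡⟨ cong u (Perm.to-from V (u⁻¹ a)) ⟨
      u (v (v⁻¹ (u⁻¹ a))) ≡⟨ W≗UV _ ⟨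
      w (v⁻¹ (u⁻¹ a))     ∎)

    below⇒i<u-i : PreservesBelow u i → i < u i
    below⇒i<u-i below = crossing-at-i U-cross
      where
      crossing-at-i : Cross i u → i < u i
      crossing-at-i (a , a≤i , i<u-a) with m≤n⇒m<n∨m≡n a≤i
      ... | inj₁ a<i  = ⊥-elim (<-asym i<u-a (below a<i))
      ... | inj₂ refl = i<u-a

    preserves⇒u-1+i≤i : Preserves u (suc i) → u (suc i) ≤ i
    preserves⇒u-1+i≤i pres = crossing-below U-cross
      where
      crossing-below : Cross i u → u (suc i) ≤ i
      crossing-below (a , a≤i , i<u-a) = m<1+n⇒m≤n (≤∧≢⇒< (pres ≤-refl) u-1+i≢1+i)
        where
        u-a≡1+i : u a ≡ suc i
        u-a≡1+i = ≤-antisym (pres (m≤n⇒m≤1+n a≤i)) i<u-a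
        u-1+i≢1+i : u (suc i) ≢ suc i
        u-1+i≢1+i eq = 1+n≰n (subst (_≤ i) (Perm.to-injective U (trans u-a≡1+i (sym eq))) a≤i)

    preserves⇒u-i<i : Preserves u (suc i) → u i < i
    preserves⇒u-i<i pres = <-≤-trans U-asc (preserves⇒u-1+i≤i pres)

    u-preserves-not-both : PreservesBelow u i → Preserves u (suc i) → ⊥
    u-preserves-not-both below pres = <-asym (below⇒i<u-i below) (preserves⇒u-i<i pres)

    v-preserves-not-both : PreservesBelow v i → Preserves v (suc i) → ⊥
    v-preserves-not-both below pres =
      <-asym U-asc (subst₂ _<_ (trans (W≗UV i) (cong u v-i≡1+i)) (trans (W≗UV (suc i)) (cong u v-1+i≡i)) W-asc)
      where
      v⁻¹-i≤1+i : v⁻¹ i ≤ suc i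
      v⁻¹-i≤1+i = preserves⇒from-preserves V pres (n≤1+n i)
      v⁻¹-1+i≡i : v⁻¹ (suc i) ≡ i
      v⁻¹-1+i≡i = ≤-antisym (m<1+n⇒m≤n (<-≤-trans V-desc v⁻¹-i≤1+i))
                    (preservesBelow⇒above (V ⁻¹ᵖ) (preservesBelow⇒from V below) (n≤1+n i))
      v⁻¹-i≡1+i : v⁻¹ i ≡ suc i
      v⁻¹-i≡1+i = ≤-antisym v⁻¹-i≤1+i (subst (λ x → suc x ≤ v⁻¹ i) v⁻¹-1+i≡i V-desc)
      v-1+i≡i : v (suc i) ≡ i
      v-1+i≡i = trans (cong v (sym v⁻¹-i≡1+i)) (Perm.to-from V i)
      v-i≡1+i : v i ≡ suc i
      v-i≡1+i = trans (cong v (sym v⁻¹-1+i≡i)) (Perm.to-from V (suc i))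

    descent-above-splits : 0 < i → PreservesBelow u i → Preserves v (suc i) →
                           w (suc (suc i)) < w (suc i) → Splits W
    descent-above-splits 0<i below pres desc = pred i , subst (_< m) (sym 1+k≡i) i<m , inj₂ almost
      where
      1+k≡i : suc (pred i) ≡ i
      1+k≡i = suc-pred i {{>-nonZero 0<i}}
      i≤w-2+i : i ≤ w (suc (suc i))
      i≤w-2+i = subst (i ≤_) (sym (W≗UV _))
        (preservesBelow⇒above U below (≤-trans (n≤1+n i) (<⇒≤ (preserves⇒preserves-above V pres (n<1+n (suc i))))))
      almost : AlmostPreserves w⁻¹ (pred i)
      almost {a} a≤k = subst (_≤ suc (pred i)) (sym (w⁻¹≗ a)) (subst (v⁻¹ (u⁻¹ a) ≤_) (sym 1+k≡i)
        (m<1+n⇒m≤n (≤∧≢⇒< (preserves⇒from-preserves V pres (m≤n⇒m≤1+n (<⇒≤ u⁻¹-a<i))) ≢1+i)))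
        where
        a<i : a < i
        a<i = subst (a <_) 1+k≡i (s≤s a≤k)
        u⁻¹-a<i : u⁻¹ a < i
        u⁻¹-a<i = preservesBelow⇒from U below a<i
        ≢1+i : v⁻¹ (u⁻¹ a) ≢ suc i
        ≢1+i eq = <-irrefl refl (<-trans (<-≤-trans a<i i≤w-2+i) (subst (w (suc (suc i)) <_) w-1+i≡a desc))
          where
          w-1+i≡a : w (suc i) ≡ a
          w-1+i≡a = trans (cong w (trans (sym eq) (sym (w⁻¹≗ a)))) (Perm.to-from W a)

    descent-below-impossible : PreservesBelow u i → Preserves v (suc i) →
                               ∀ {t} → i ≡ suc t → w⁻¹ i < w⁻¹ t → ⊥
    descent-below-impossible below pres {t} i≡1+t desc =
      <⇒≱ (<-trans 1+i<w⁻¹-i desc) w⁻¹-t≤1+i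
      where
      w⁻¹-t≤1+i : w⁻¹ t ≤ suc i
      w⁻¹-t≤1+i = subst (_≤ suc i) (sym (w⁻¹≗ t)) (preserves⇒from-preserves V pres
        (m≤n⇒m≤1+n (<⇒≤ (preservesBelow⇒from U below (subst (t <_) (sym i≡1+t) (n<1+n t))))))
      u⁻¹-i≢i : u⁻¹ i ≢ i
      u⁻¹-i≢i eq = <⇒≢ (below⇒i<u-i below) (sym (trans (cong u (sym eq)) (Perm.to-from U i)))
      u⁻¹-i≢1+i : u⁻¹ i ≢ suc i
      u⁻¹-i≢1+i eq = <⇒≢ (<-trans (below⇒i<u-i below) U-asc) (sym (trans (cong u (sym eq)) (Perm.to-from U i)))
      1+i<u⁻¹-i : suc i < u⁻¹ i
      1+i<u⁻¹-i = ≤∧≢⇒< (≤∧≢⇒< (preservesBelow⇒above (U ⁻¹ᵖ) (preservesBelow⇒from U below) ≤-refl)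
                                 (u⁻¹-i≢i ∘ sym)) (u⁻¹-i≢1+i ∘ sym)
      1+i<w⁻¹-i : suc i < w⁻¹ i
      1+i<w⁻¹-i = subst (suc i <_) (sym (w⁻¹≗ i))
        (preserves⇒preserves-above (V ⁻¹ᵖ) (preserves⇒from-preserves V pres) 1+i<u⁻¹-i)

    descent-above-impossible : PreservesBelow v i → Preserves u (suc i) →
                               w⁻¹ (suc (suc i)) < w⁻¹ (suc i) → ⊥
    descent-above-impossible below pres desc = <-asym desc (<-≤-trans w⁻¹-1+i<i i≤w⁻¹-2+i)
      where
      u⁻¹-1+i≢1+i : u⁻¹ (suc i) ≢ suc i
      u⁻¹-1+i≢1+i eq =
        1+n≰n (subst (_≤ i) (trans (cong u (sym eq)) (Perm.to-from U (suc i))) (preserves⇒u-1+i≤i pres))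
      u⁻¹-1+i≢i : u⁻¹ (suc i) ≢ i
      u⁻¹-1+i≢i eq =
        <-asym (preserves⇒u-i<i pres) (subst (i <_) (sym (trans (cong u (sym eq)) (Perm.to-from U (suc i)))) (n<1+n i))
      u⁻¹-1+i<i : u⁻¹ (suc i) < i
      u⁻¹-1+i<i = ≤∧≢⇒< (m<1+n⇒m≤n (≤∧≢⇒< (preserves⇒from-preserves U pres ≤-refl) u⁻¹-1+i≢1+i)) u⁻¹-1+i≢i
      w⁻¹-1+i<i : w⁻¹ (suc i) < i
      w⁻¹-1+i<i = subst (_< i) (sym (w⁻¹≗ (suc i))) (preservesBelow⇒from V below u⁻¹-1+i<i)
      i≤w⁻¹-2+i : i ≤ w⁻¹ (suc (suc i))
      i≤w⁻¹-2+i = subst (i ≤_) (sym (w⁻¹≗ _)) (preservesBelow⇒above (V ⁻¹ᵖ) (preservesBelow⇒from V below)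
        (≤-trans (n≤1+n i)
          (<⇒≤ (preserves⇒preserves-above (U ⁻¹ᵖ) (preserves⇒from-preserves U pres) (n<1+n (suc i))))))

    descent-below-splits : PreservesBelow v i → suc i < m → Preserves u (suc i) →
                           ∀ {t} → i ≡ suc t → w i < w t → Splits W
    descent-below-splits below 1+i<m pres {t} i≡1+t desc = i , 1+i<m , inj₁ almost
      where
      w-below : ∀ {p} → p < i → w p ≤ suc i
      w-below {p} p<i = subst (_≤ suc i) (sym (W≗UV p)) (pres (m≤n⇒m≤1+n (<⇒≤ (below p<i))))
      almost : AlmostPreserves w i
      almost {p} p≤i with m≤n⇒m<n∨m≡n p≤i
      ... | inj₁ p<i  = w-below p<i
      ... | inj₂ refl = <⇒≤ (<-≤-trans desc (w-below (subst (t <_) (sym i≡1+t) (n<1+n t))))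

    adjacent-descent-splits :
      (0 < i × PreservesBelow u i) ⊎ PreservesBelow v i →
      (suc i < m × Preserves u (suc i)) ⊎ Preserves v (suc i) →
      ∀ {t} → w⁻¹ (suc t) < w⁻¹ t → w (suc t) < w t → t ≡ suc i ⊎ i ≡ suc t → Splits W
    adjacent-descent-splits (inj₁ (_ , u-below)) (inj₁ (_ , u-pres)) _ _ _ =
      ⊥-elim (u-preserves-not-both u-below u-pres)
    adjacent-descent-splits (inj₂ v-below) (inj₂ v-pres) _ _ _ = ⊥-elim (v-preserves-not-both v-below v-pres)
    adjacent-descent-splits (inj₁ (0<i , u-below)) (inj₂ v-pres) _ desc-R (inj₁ refl) =
      descent-above-splits 0<i u-below v-pres desc-R
    adjacent-descent-splits (inj₁ (_ , u-below)) (inj₂ v-pres) {t} desc-L _ (inj₂ i≡1+t) =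
      ⊥-elim (descent-below-impossible u-below v-pres i≡1+t (subst (λ j → w⁻¹ j < w⁻¹ t) (sym i≡1+t) desc-L))
    adjacent-descent-splits (inj₂ v-below) (inj₁ (_ , u-pres)) desc-L _ (inj₁ refl) =
      ⊥-elim (descent-above-impossible v-below u-pres desc-L)
    adjacent-descent-splits (inj₂ v-below) (inj₁ (1+i<m , u-pres)) {t} _ desc-R (inj₂ i≡1+t) =
      descent-below-splits v-below 1+i<m u-pres i≡1+t (subst (λ j → w j < w t) (sym i≡1+t) desc-R)

  neighbour-preserved : ∀ {J u v i} → InParabolic J v → (∀ s → s ∈supp u × s ∈ˢ J → s ≡ i) →
                        ∀ {j} → j < m → j ≢ toℕ i → Preserves ⟦ u ⟧ j ⊎ Preserves ⟦ v ⟧ j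
  neighbour-preserved {J} {u} {v} {i} v∈W_J supp∩J⊆i {j} j<m j≢i =
    subst (λ j → Preserves ⟦ u ⟧ j ⊎ Preserves ⟦ v ⟧ j) (toℕ-fromℕ< j<m) (by-membership (s ∈ˢ? J))
    where
    s : Fin m
    s = fromℕ< j<m
    by-membership : Dec (s ∈ˢ J) → Preserves ⟦ u ⟧ (toℕ s) ⊎ Preserves ⟦ v ⟧ (toℕ s)
    by-membership (yes s∈J) = inj₁ (∉supp⇒preserves {s} {u} (λ s∈supp →
                                j≢i (trans (sym (toℕ-fromℕ< j<m)) (cong toℕ (supp∩J⊆i s (s∈supp , s∈J))))))
    by-membership (no  s∉J) = inj₂ (parabolic⇒preserves {J} {v} v∈W_J s∉J)

  module _ {f g : ℕ → ℕ} where

    left-neighbour : ∀ i → i < m → (∀ {j} → j < m → j ≢ i → Preserves f j ⊎ Preserves g j) →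
                     (0 < i × PreservesBelow f i) ⊎ PreservesBelow g i
    left-neighbour zero    _     _         = inj₂ (λ ())
    left-neighbour (suc k) 1+k<m neighbour with neighbour (<-trans (n<1+n k) 1+k<m) (<⇒≢ (n<1+n k))
    ... | inj₁ f-pres = inj₁ (z<s , preserves⇒preservesBelow f-pres)
    ... | inj₂ g-pres = inj₂ (preserves⇒preservesBelow g-pres)

    right-neighbour : ∀ i → i < m → (∀ {j} → j < m → j ≢ i → Preserves f j ⊎ Preserves g j) →
                      Preserves g m → (suc i < m × Preserves f (suc i)) ⊎ Preserves g (suc i)
    right-neighbour i i<m neighbour g-pres with suc i <? m
    ... | no  1+i≮m = inj₂ (subst (Preserves g) (≤-antisym (≮⇒≥ 1+i≮m) i<m) g-pres)
    ... | yes 1+i<m with neighbour 1+i<m (>⇒≢ (n<1+n i))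
    ...   | inj₁ f-pres  = inj₁ (1+i<m , f-pres)
    ...   | inj₂ g-pres′ = inj₂ g-pres′

  commute-unless-adjacent : ∀ i s → ¬ (toℕ s ≡ suc (toℕ i) ⊎ toℕ i ≡ suc (toℕ s)) →
                            (i ∷ s ∷ []) ≈ (s ∷ i ∷ [])
  commute-unless-adjacent i s ¬adjacent =
    ≗⇒≈ {i ∷ s ∷ []} {s ∷ i ∷ []} (τ-comm (¬adjacent ∘ inj₂) (¬adjacent ∘ inj₁))

corollary5p5 : (m : ℕ) (w : Word m) (J : Subset m) (i : Fin m) →
    BruhatIrreducible w → AlmostReducible w J i →
    ∀ s → DL w s → DR w s → (i ∷ s ∷ []) ≈ (s ∷ i ∷ [])
corollary5p5 m w J i irreducible (_ , (u , v , ((u-min , v∈W_J , w≈uv) , bp) , supp∩J≡i) , _ , i∉DR) s s∈DL s∈DR =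
  commute-unless-adjacent i s
    (irreducible⇒¬splits w irreducible ∘
      adjacent-descent-splits (left-neighbour (toℕ i) (toℕ<n i) neighbour)
        (right-neighbour (toℕ i) (toℕ<n i) neighbour (Perm.to-bounded (perm v)))
        (DL⇒descent {w} {s} s∈DL) (DR⇒descent {w} {s} s∈DR))
  where
  open Symmetric m
  i∈supp-u : i ∈supp u
  i∈supp-u = proj₁ (proj₂ (supp∩J≡i i) refl)
  i∈J : i ∈ˢ J
  i∈J = proj₂ (proj₂ (supp∩J≡i i) refl)
  neighbour : ∀ {j} → j < m → j ≢ toℕ i → Preserves ⟦ u ⟧ j ⊎ Preserves ⟦ v ⟧ j
  neighbour = neighbour-preserved {J} {u} {v} {i} v∈W_J (λ s → proj₁ (supp∩J≡i s))
  open AdjacentDescent (perm u) (perm v) (perm w) (λ a → trans (≈⇒≗ {w} {u ++ v} w≈uv a) (⟦⟧-++ u v a)) (toℕ<n i)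
         (minCoset⇒ascent {J} {w} {u} u-min i∈J) (∈supp⇒cross {i} {u} i∈supp-u)
         (DL⇒descent {v} {i} (bp i i∈supp-u i∈J)) (¬DR⇒ascent {w} {i} i∉DR)
         using (adjacent-descent-splits)
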